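{- Let $\mathcal{R}$ be a term rewrite system that is orthogonal and right-linear (equivalently, non-overlapping and linear). Then $\mathrm{dc}_{\xrightarrow{\mathbf{f}}_{\mathcal{R}}}=\mathrm{dc}_{\xrightarrow{\mathbf{i}}_{\mathcal{R}}}$.
   Context: A TRS is a countable set $\mathcal{R}$ of rules $\ell\to r$ with $\ell$ a non-variable term and $\mathcal{V}(r)\subseteq\mathcal{V}(\ell)$. $s\xrightarrow{\mathbf{f}}_{\mathcal{R}}t$ iff $s|_\pi=\ell\sigma$ and $t=s[r\sigma]_\pi$ for some position $\pi$, rule $\ell\to r$ and substitution $\sigma$; the step is innermost ($\xrightarrow{\mathbf{i}}_{\mathcal{R}}$) if all proper subterms of $\ell\sigma$ are normal forms. Derivation height $\mathrm{dh}_\to(t)=\sup\{m\mid\exists t'.\ t\to^m t'\}\in\mathbb{N}\cup\{\omega\}$; size $|x|=1$, $|f(t_1,\dots,t_k)|=1+\sum|t_i|$; derivational complexity $\mathrm{dc}_\to(n)=\sup\{\mathrm{dh}_\to(t)\mid|t|\le n\}$. Non-overlapping: no two rules (renamed apart) $\ell_1\to r_1,\ell_2\to r_2$ and non-variable position $\pi$ of $\ell_1$ with $\ell_1|_\pi$ and $\ell_2$ unifiable (with $\pi\ne\varepsilon$ if it is the same rule); left-/right-linear: no variable occurs twice in any left-/right-hand side; orthogonal: non-overlapping and left-linear. -}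

module Defs where

open import Data.Nat using (ℕ; zero; suc; _+_; _≤_; _≟_)
open import Data.Fin using (Fin; toℕ)
open import Data.Vec using (Vec; []; _∷_; lookup; _[_]≔_)
open import Data.List using (List; []; _∷_)
open import Data.Product using (Σ; ∃; _×_; _,_)
open import Relation.Nullary using (¬_; yes; no)
open import Relation.Binary.PropositionalEquality using (_≡_; _≢_)
open import Function.Definitions using (Injective)

data ℕω : Set where
  fin : ℕ → ℕω
  ω   : ℕω

data _≤ω_ : ℕω → ℕω → Set where
  fin≤fin : ∀ {m n} → m ≤ n → fin m ≤ω fin n
  ≤ω-top  : ∀ {x} → x ≤ω ω

IsSup : (ℕω → Set) → ℕω → Set
IsSup S x = (∀ y → S y → y ≤ω x) × (∀ u → (∀ y → S y → y ≤ω u) → x ≤ω u)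

Var : Set
Var = ℕ

module TRS (F : Set) (arity : F → ℕ) where

  data Term : Set where
    var : Var → Term
    fun : (f : F) → Vec Term (arity f) → Term

  size  : Term → ℕ
  sizes : ∀ {k} → Vec Term k → ℕ
  size (var x)    = 1
  size (fun f ts) = suc (sizes ts)
  sizes []       = 0
  sizes (t ∷ ts) = size t + sizes ts

  Subst : Set
  Subst = Var → Term

  _·_  : Term → Subst → Term
  _·*_ : ∀ {k} → Vec Term k → Subst → Vec Term k
  var x    · σ = σ x
  fun f ts · σ = fun f (ts ·* σ)
  []       ·* σ = []
  (t ∷ ts) ·* σ = (t · σ) ∷ (ts ·* σ)

  data _∈𝒱_ (x : Var) : Term → Set where
    here  : x ∈𝒱 var x
    there : ∀ {f ts} (i : Fin (arity f)) → x ∈𝒱 lookup ts i → x ∈𝒱 fun f ts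

  occ  : Var → Term → ℕ
  occs : ∀ {k} → Var → Vec Term k → ℕ
  occ x (var y) with x ≟ y
  ... | yes _ = 1
  ... | no  _ = 0
  occ x (fun f ts) = occs x ts
  occs x []       = 0
  occs x (t ∷ ts) = occ x t + occs x ts

  Linear : Term → Set
  Linear t = ∀ x → occ x t ≤ 1

  IsVar : Term → Set
  IsVar t = ∃ λ x → t ≡ var x

  -- positions (sequences of argument indices, 0-based) and t|π ≡ u
  Pos : Set
  Pos = List ℕ

  data _∣_≡_ : Term → Pos → Term → Set where
    root : ∀ {t} → t ∣ [] ≡ t
    arg  : ∀ {f ts π u} (i : Fin (arity f)) →
           lookup ts i ∣ π ≡ u → fun f ts ∣ (toℕ i ∷ π) ≡ u

  data _⊴_ : Term → Term → Set
  data _◁_ : Term → Term → Set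
  data _⊴_ where
    refl⊴ : ∀ {t} → t ⊴ t
    strict : ∀ {s t} → s ◁ t → s ⊴ t
  data _◁_ where
    sub : ∀ {s f ts} (i : Fin (arity f)) → s ⊴ lookup ts i → s ◁ fun f ts

  Rule : Set
  Rule = Term × Term

  -- A TRS: a countable set of rules, presented as a family indexed by a
  -- countable type I (injection into ℕ).

  record IsTRS (I : Set) (ℛ : I → Rule) : Set where
    field
      countable : Σ (I → ℕ) (λ g → Injective _≡_ _≡_ g)
      lhs-nonvar : ∀ i → let (ℓ , r) = ℛ i in ¬ IsVar ℓ
      vars-⊆     : ∀ i → let (ℓ , r) = ℛ i in ∀ x → x ∈𝒱 r → x ∈𝒱 ℓ

  module Rewriting {I : Set} (ℛ : I → Rule) where

    data _→f_ : Term → Term → Set where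
      root : ∀ i σ → let (ℓ , r) = ℛ i in (ℓ · σ) →f (r · σ)
      cong : ∀ {f ts t'} (j : Fin (arity f)) →
             lookup ts j →f t' → fun f ts →f fun f (ts [ j ]≔ t')

    NF : Term → Set
    NF t = ¬ ∃ λ t' → t →f t'

    data _→i_ : Term → Term → Set where
      root : ∀ i σ → let (ℓ , r) = ℛ i in
             (∀ u → u ◁ (ℓ · σ) → NF u) → (ℓ · σ) →i (r · σ)
      cong : ∀ {f ts t'} (j : Fin (arity f)) →
             lookup ts j →i t' → fun f ts →i fun f (ts [ j ]≔ t')

    data _^_∋_⟶_ (_⇒_ : Term → Term → Set) : ℕ → Term → Term → Set where
      done : ∀ {t} → _⇒_ ^ 0 ∋ t ⟶ t
      step : ∀ {m s t u} → s ⇒ t → _⇒_ ^ m ∋ t ⟶ u → _⇒_ ^ suc m ∋ s ⟶ u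

    -- dc_⇒(n) = sup { dh_⇒(t) | |t| ≤ n }
    --         = sup { m | ∃ t. |t| ≤ n ∧ ∃ t'. t ⇒^m t' }   (sup of sups)
    -- IsDC ⇒ n x  :  x = dc_⇒(n)
    IsDC : (Term → Term → Set) → ℕ → ℕω → Set
    IsDC _⇒_ n x = IsSup (λ y → ∃ λ m → y ≡ fin m ×
                           (∃ λ t → size t ≤ n × ∃ λ t' → _⇒_ ^ m ∋ t ⟶ t')) x

  NonOverlapping : {I : Set} → (I → Rule) → Set
  NonOverlapping {I} ℛ =
    ∀ (i₁ i₂ : I) (π : Pos) (u : Term) →
      let (ℓ₁ , r₁) = ℛ i₁ ; (ℓ₂ , r₂) = ℛ i₂ in
      ℓ₁ ∣ π ≡ u → ¬ IsVar u → (i₁ ≡ i₂ → π ≢ []) →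
      -- rules renamed apart: independent substitutions
      ¬ (∃ λ σ₁ → ∃ λ σ₂ → u · σ₁ ≡ ℓ₂ · σ₂)

  LeftLinear : {I : Set} → (I → Rule) → Set
  LeftLinear {I} ℛ = ∀ i → let (ℓ , r) = ℛ i in Linear ℓ

  RightLinear : {I : Set} → (I → Rule) → Set
  RightLinear {I} ℛ = ∀ i → let (ℓ , r) = ℛ i in Linear r

  Orthogonal : {I : Set} → (I → Rule) → Set
  Orthogonal ℛ = NonOverlapping ℛ × LeftLinear ℛ

{-# OPTIONS --safe #-}
-- An innermost step s →i s₁ and a full step s →f u from the same term close as s₁ →f v ←i⁼ u,
-- unless already u ≡ s₁.  Steps at disjoint positions commute.  A full step cannot occur strictly
-- inside the innermost redex, whose proper subterms are normal forms; at the same position both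
-- steps use the same rule and hence coincide; above it, left-linearity and non-overlap place the
-- innermost redex inside the substitution part of the outer redex, which survives, and
-- right-linearity lets at most one copy of it reach the contractum.  Hence an innermost step
-- lowers the full derivation height by at most one, and contracting innermost redexes one at a
-- time turns every full derivation of length m into an innermost one of length m.  Innermost
-- redexes are found only under ¬¬ (being a normal form is undecidable when there are infinitely
-- many rules), which suffices because _≤ω_ is decidable.
module Submission where

open import Defs
open import Data.Nat using (ℕ; zero; suc; _≤_; _≟_)
open import Data.Nat.Properties using (≤-trans; ≤-reflexive; <-irrefl; +-mono-≤; m≤m+n; m≤n+m; _≤?_)
open import Data.Fin using (Fin; zero; suc) renaming (_≟_ to _≟ᶠ_)
open import Data.Vec using (Vec; []; _∷_; lookup; _[_]≔_)
open import Data.Vec.Properties using (lookup∘update; lookup∘update′; []≔-idempotent; []≔-commutes)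
open import Data.Product using (∃; ∃-syntax; _×_; _,_; proj₁; proj₂; map₂; uncurry)
open import Data.Sum using (inj₁; inj₂; [_,_]′)
open import Data.Empty using (⊥-elim)
open import Data.List using ([])
open import Function using (_∘_)
open import Function.Bundles using (mk↣)
open import Function.Definitions using (Injective)
open import Relation.Nullary using (¬_; Dec; yes; no)
open import Relation.Nullary.Decidable using (map′; _⊎-dec_; decidable-stable; via-injection)
open import Relation.Nullary.Negation using (¬¬-map; contradiction)
open import Relation.Binary.Definitions using (Decidable; DecidableEquality)
open import Relation.Binary.Construct.Closure.Reflexive using (ReflClosure; refl; [_])
import Relation.Binary.Construct.Closure.Reflexive as ReflClosure
open import Relation.Binary.PropositionalEquality using (_≡_; refl; sym; cong₂; subst; _≢_; module ≡-Reasoning)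
import Relation.Binary.PropositionalEquality as ≡

_≤ω?_ : Decidable _≤ω_
fin m ≤ω? fin n = map′ fin≤fin (λ { (fin≤fin m≤n) → m≤n }) (m ≤? n)
fin m ≤ω? ω     = yes ≤ω-top
ω     ≤ω? fin n = no λ ()
ω     ≤ω? ω     = yes ≤ω-top

UpperBound : (ℕω → Set) → ℕω → Set
UpperBound S u = ∀ y → S y → y ≤ω u

IsSup-cong : ∀ {S T x} → (∀ {u} → UpperBound T u → UpperBound S u) →
             (∀ {u} → UpperBound S u → UpperBound T u) → IsSup S x → IsSup T x
IsSup-cong ubT⇒ubS ubS⇒ubT (upper , least) = ubS⇒ubT upper , λ u upperT → least u (ubT⇒ubS upperT)

countable⇒decidableEquality : ∀ {I : Set} → ∃[ g ] Injective _≡_ _≡_ g → DecidableEquality I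
countable⇒decidableEquality (_ , injective) = via-injection (mk↣ injective) _≟_

module _ (F : Set) (arity : F → ℕ) where
  open TRS F arity

  infixl 30 _[_↦_]

  _[_↦_] : Subst → Var → Term → Subst
  (σ [ x ↦ b ]) y with y ≟ x
  ... | yes _ = b
  ... | no  _ = σ y

  [↦]-same : ∀ {σ x b} → (σ [ x ↦ b ]) x ≡ b
  [↦]-same {x = x} with x ≟ x
  ... | yes _ = refl
  ... | no x≢x = contradiction refl x≢x

  [↦]-other : ∀ {σ x b y} → y ≢ x → (σ [ x ↦ b ]) y ≡ σ y
  [↦]-other {x = x} {y = y} y≢x with y ≟ x
  ... | yes y≡x = contradiction y≡x y≢x
  ... | no  _   = refl

  lookup-·* : ∀ {k} (ts : Vec Term k) σ j → lookup (ts ·* σ) j ≡ lookup ts j · σ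
  lookup-·* (t ∷ ts) σ zero    = refl
  lookup-·* (t ∷ ts) σ (suc j) = lookup-·* ts σ j

  fun-injective : ∀ {f} {ts us : Vec Term (arity f)} → fun f ts ≡ fun f us → ts ≡ us
  fun-injective refl = refl

  ·-cong  : ∀ t {σ σ′} → (∀ {x} → x ∈𝒱 t → σ x ≡ σ′ x) → t · σ ≡ t · σ′
  ·*-cong : ∀ {k} (ts : Vec Term k) {σ σ′} →
            (∀ {x} j → x ∈𝒱 lookup ts j → σ x ≡ σ′ x) → ts ·* σ ≡ ts ·* σ′
  ·-cong (var x)    agree = agree here
  ·-cong (fun f ts) agree = ≡.cong (fun f) (·*-cong ts λ j x∈ → agree (there j x∈))
  ·*-cong []       agree = refl
  ·*-cong (t ∷ ts) agree = cong₂ _∷_ (·-cong t (agree zero)) (·*-cong ts (agree ∘ suc))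

  ·≡·⇒agree : ∀ {t σ σ′ x} → t · σ ≡ t · σ′ → x ∈𝒱 t → σ x ≡ σ′ x
  ·≡·⇒agree eq here = eq
  ·≡·⇒agree {fun f ts} {σ} {σ′} eq (there j x∈) = ·≡·⇒agree (begin
    lookup ts j · σ       ≡⟨ sym (lookup-·* ts σ j) ⟩
    lookup (ts ·* σ) j    ≡⟨ ≡.cong (λ us → lookup us j) (fun-injective eq) ⟩
    lookup (ts ·* σ′) j   ≡⟨ lookup-·* ts σ′ j ⟩
    lookup ts j · σ′      ∎) x∈
    where open ≡-Reasoning

  ·-fresh : ∀ t {σ x b} → ¬ x ∈𝒱 t → t · σ ≡ t · σ [ x ↦ b ]
  ·-fresh t x∉ = ·-cong t λ {y} y∈ → sym ([↦]-other {y = y} λ { refl → x∉ y∈ })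

  ·*-fresh : ∀ {k} (ts : Vec Term k) {σ x b} → (∀ j → ¬ x ∈𝒱 lookup ts j) →
             ts ·* σ ≡ ts ·* σ [ x ↦ b ]
  ·*-fresh ts x∉ = ·*-cong ts λ {y} j y∈ → sym ([↦]-other {y = y} λ { refl → x∉ j y∈ })

  _∈𝒱?_ : ∀ x t → Dec (x ∈𝒱 t)
  ∈𝒱-lookup? : ∀ {k} x (ts : Vec Term k) → Dec (∃[ j ] x ∈𝒱 lookup ts j)
  x ∈𝒱? var y    = map′ (λ { refl → here }) (λ { here → refl }) (x ≟ y)
  x ∈𝒱? fun f ts = map′ (uncurry there) (λ { (there j x∈) → j , x∈ }) (∈𝒱-lookup? x ts)
  ∈𝒱-lookup? x []       = no λ { (() , _) }
  ∈𝒱-lookup? x (t ∷ ts) =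
    map′ [ (λ x∈ → zero , x∈) , (λ (j , x∈) → suc j , x∈) ]′
         (λ { (zero , x∈) → inj₁ x∈ ; (suc j , x∈) → inj₂ (j , x∈) })
         (x ∈𝒱? t ⊎-dec ∈𝒱-lookup? x ts)

  occ-self : ∀ x → occ x (var x) ≡ 1
  occ-self x with x ≟ x
  ... | yes _ = refl
  ... | no x≢x = contradiction refl x≢x

  occ-lookup≤occs : ∀ {k} x (ts : Vec Term k) j → occ x (lookup ts j) ≤ occs x ts
  occ-lookup≤occs x (t ∷ ts) zero    = m≤m+n _ _
  occ-lookup≤occs x (t ∷ ts) (suc j) = ≤-trans (occ-lookup≤occs x ts j) (m≤n+m _ _)

  ∈𝒱⇒1≤occ : ∀ {x t} → x ∈𝒱 t → 1 ≤ occ x t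
  ∈𝒱⇒1≤occ {x} here                   = ≤-reflexive (sym (occ-self x))
  ∈𝒱⇒1≤occ {x} (there {ts = ts} j x∈) = ≤-trans (∈𝒱⇒1≤occ x∈) (occ-lookup≤occs x ts j)

  ∈𝒱-head-and-tail⇒occs≰1 : ∀ {k x t} {ts : Vec Term k} {j} →
                             x ∈𝒱 t → x ∈𝒱 lookup ts j → ¬ occs x (t ∷ ts) ≤ 1
  ∈𝒱-head-and-tail⇒occs≰1 {x = x} {ts = ts} {j} x∈t x∈ts occs≤1 = <-irrefl refl
    (≤-trans (+-mono-≤ (∈𝒱⇒1≤occ x∈t) (≤-trans (∈𝒱⇒1≤occ x∈ts) (occ-lookup≤occs x ts j))) occs≤1)

  Linear-lookup : ∀ {f ts} → Linear (fun f ts) → ∀ j → Linear (lookup ts j)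
  Linear-lookup {ts = ts} linear j x = ≤-trans (occ-lookup≤occs x ts j) (linear x)

  ·*-[]≔-[↦] : ∀ {k} (ts : Vec Term k) j {σ x b} → occs x ts ≤ 1 → x ∈𝒱 lookup ts j →
               (ts ·* σ) [ j ]≔ (lookup ts j · σ [ x ↦ b ]) ≡ ts ·* σ [ x ↦ b ]
  ·*-[]≔-[↦] (t ∷ ts) zero    occs≤1 x∈ =
    ≡.cong (_ ∷_) (·*-fresh ts λ i x∈ts → ∈𝒱-head-and-tail⇒occs≰1 {ts = ts} x∈ x∈ts occs≤1)
  ·*-[]≔-[↦] (t ∷ ts) (suc j) occs≤1 x∈ =
    cong₂ _∷_ (·-fresh t λ x∈t → ∈𝒱-head-and-tail⇒occs≰1 {ts = ts} x∈t x∈ occs≤1)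
              (·*-[]≔-[↦] ts j (≤-trans (m≤n+m _ _) occs≤1) x∈)

  Monotone : (Term → Term → Set) → Set
  Monotone _⇒_ = ∀ {f ts t′} (j : Fin (arity f)) → lookup ts j ⇒ t′ → fun f ts ⇒ fun f (ts [ j ]≔ t′)

  module _ (_⇒_ : Term → Term → Set) (monotone : Monotone _⇒_) where

    ⇒-[]≔ : ∀ {f} {ts : Vec Term (arity f)} j {a b} → a ⇒ b → fun f (ts [ j ]≔ a) ⇒ fun f (ts [ j ]≔ b)
    ⇒-[]≔ {f} {ts} j {a} {b} a⇒b =
      subst (λ us → fun f (ts [ j ]≔ a) ⇒ fun f us) ([]≔-idempotent ts j)
            (monotone j (subst (_⇒ b) (sym (lookup∘update j ts a)) a⇒b))

    ⇒-[]≔-other : ∀ {f} {ts : Vec Term (arity f)} {i j a t′} → j ≢ i → lookup ts j ⇒ a →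
                  fun f (ts [ i ]≔ t′) ⇒ fun f ((ts [ i ]≔ t′) [ j ]≔ a)
    ⇒-[]≔-other {ts = ts} {t′ = t′} j≢i tⱼ⇒a =
      monotone _ (subst (_⇒ _) (sym (lookup∘update′ j≢i ts t′)) tⱼ⇒a)

    ·-[↦]-step : ∀ r {σ x b} → occ x r ≤ 1 → x ∈𝒱 r → σ x ⇒ b → (r · σ) ⇒ (r · σ [ x ↦ b ])
    ·-[↦]-step (var x) {σ} occ≤1 here σx⇒b = subst (σ x ⇒_) (sym ([↦]-same {σ} {x})) σx⇒b
    ·-[↦]-step (fun f rs) {σ} {x} {b} occs≤1 (there j x∈) σx⇒b =
      subst (λ us → fun f (rs ·* σ) ⇒ fun f us) (·*-[]≔-[↦] rs j occs≤1 x∈)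
            (monotone j (subst (_⇒ (lookup rs j · σ [ x ↦ b ])) (sym (lookup-·* rs σ j))
              (·-[↦]-step (lookup rs j) (≤-trans (occ-lookup≤occs x rs j) occs≤1) x∈ σx⇒b)))

    ·-[↦]-step⁼ : ∀ r {σ x b} → occ x r ≤ 1 → σ x ⇒ b → ReflClosure _⇒_ (r · σ) (r · σ [ x ↦ b ])
    ·-[↦]-step⁼ r {x = x} occ≤1 σx⇒b with x ∈𝒱? r
    ... | yes x∈ = [ ·-[↦]-step r occ≤1 x∈ σx⇒b ]
    ... | no  x∉ = subst (ReflClosure _⇒_ _) (·-fresh r x∉) refl

  module _ {I : Set} (ℛ : I → Rule) where
    open Rewriting ℛ

    lhs rhs : I → Term
    lhs i = proj₁ (ℛ i)
    rhs i = proj₂ (ℛ i)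

    Overlaps : Term → Set
    Overlaps u = ∃[ i ] ∃[ σ₁ ] ∃[ σ₂ ] u · σ₁ ≡ lhs i · σ₂

    OverlapFree : Term → Set
    OverlapFree p = ∀ {π u} → p ∣ π ≡ u → ¬ IsVar u → ¬ Overlaps u

    ProperlyOverlapFree : Term → Set
    ProperlyOverlapFree p = ∀ {π u} → p ∣ π ≡ u → π ≢ [] → ¬ IsVar u → ¬ Overlaps u

    →i-step-in-pattern : ∀ p {σ s a} → Linear p → OverlapFree p → s ≡ p · σ → s →i a →
                         ∃[ x ] ∃[ b ] σ x →i b × a ≡ p · σ [ x ↦ b ] × x ∈𝒱 p
    →i-step-in-argument : ∀ {f} (ps : Vec Term (arity f)) j {σ a} → Linear (fun f ps) →
                          OverlapFree (lookup ps j) → lookup (ps ·* σ) j →i a →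
                          ∃[ x ] ∃[ b ] σ x →i b × fun f ((ps ·* σ) [ j ]≔ a) ≡ fun f ps · σ [ x ↦ b ]
                                        × x ∈𝒱 fun f ps
    →i-step-in-pattern (var x) {σ} linear free refl s→a = x , _ , s→a , sym ([↦]-same {σ} {x}) , here
    →i-step-in-pattern (fun f ps) {σ} linear free eq (root i σ′ _) =
      ⊥-elim (free root (λ { (_ , ()) }) (i , σ , σ′ , sym eq))
    →i-step-in-pattern (fun f ps) linear free refl (cong j pⱼσ→a) =
      →i-step-in-argument ps j linear (free ∘ arg j) pⱼσ→a
    →i-step-in-argument ps j {σ} linear free pⱼσ→a
      with →i-step-in-pattern (lookup ps j) (Linear-lookup {ts = ps} linear j) free (lookup-·* ps σ j) pⱼσ→a
    ... | x , b , σx→b , refl , x∈ = x , b , σx→b , ≡.cong (fun _) (·*-[]≔-[↦] ps j (linear x) x∈) , there j x∈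

    →i-argument-step-in-lhs : ∀ ℓ {σ f ts j a} → ¬ IsVar ℓ → Linear ℓ → ProperlyOverlapFree ℓ →
                              ℓ · σ ≡ fun f ts → lookup ts j →i a →
                              ∃[ x ] ∃[ b ] σ x →i b × fun f (ts [ j ]≔ a) ≡ ℓ · σ [ x ↦ b ]
    →i-argument-step-in-lhs (var y)    nonvar _ _ _ _ = contradiction (y , refl) nonvar
    →i-argument-step-in-lhs (fun g ls) {j = j} _ linear free refl tⱼ→a
      with →i-step-in-argument ls j linear (λ at → free (arg j at) λ ()) tⱼ→a
    ... | x , b , σx→b , eq , _ = x , b , σx→b , eq

    →i⇒→f : ∀ {s t} → s →i t → s →f t
    →i⇒→f (root i σ _) = root i σ
    →i⇒→f (cong j h)   = cong j (→i⇒→f h)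

    ^-map : ∀ {_⇒_ _⇛_ : Term → Term → Set} → (∀ {s t} → s ⇒ t → s ⇛ t) →
            ∀ {m s t} → _⇒_ ^ m ∋ s ⟶ t → _⇛_ ^ m ∋ s ⟶ t
    ^-map ⇒⊆⇛ done         = done
    ^-map ⇒⊆⇛ (step s⇒ d) = step (⇒⊆⇛ s⇒) (^-map ⇒⊆⇛ d)

    HasDerivation : (Term → Term → Set) → ℕ → Term → Set
    HasDerivation _⇒_ m t = ∃[ t′ ] _⇒_ ^ m ∋ t ⟶ t′

    →i-derivation⇒→f-derivation : ∀ {m t} → HasDerivation _→i_ m t → HasDerivation _→f_ m t
    →i-derivation⇒→f-derivation = map₂ (^-map →i⇒→f)

    HasDerivation-pred : ∀ {_⇒_ m t} → HasDerivation _⇒_ (suc m) t → HasDerivation _⇒_ m t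
    HasDerivation-pred {m = zero}  _               = _ , done
    HasDerivation-pred {m = suc m} (_ , step s⇒ d) = map₂ (step s⇒) (HasDerivation-pred (_ , d))

    NF-⊴ : ∀ {v w} → v ⊴ w → NF w → NF v
    NF-◁ : ∀ {v w} → v ◁ w → NF w → NF v
    NF-⊴ refl⊴        nf = nf
    NF-⊴ (strict v◁w) nf = NF-◁ v◁w nf
    NF-◁ (sub j v⊴wⱼ) nf = NF-⊴ v⊴wⱼ λ (_ , wⱼ→) → nf (_ , cong j wⱼ→)

    →f⇒→i : ∀ {s t} → s →f t → (∀ v → v ◁ s → NF v) → s →i t
    →f⇒→i (root i σ)    subterms-NF = root i σ subterms-NF
    →f⇒→i (cong j sⱼ→) subterms-NF = contradiction (_ , sⱼ→) (subterms-NF _ (sub j refl⊴))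

    InnermostNF : Term → Set
    InnermostNF t = ¬ (∃[ t′ ] t →i t′)

    InnermostNF⇒NF : ∀ t → InnermostNF t → NF t
    InnermostNF⇒proper-subterms-NF : ∀ t → InnermostNF t → ∀ v → v ◁ t → NF v
    InnermostNF⇒arguments-NF : ∀ {k} (ts : Vec Term k) → (∀ j → InnermostNF (lookup ts j)) →
                               ∀ j → NF (lookup ts j)
    InnermostNF⇒NF t inf (_ , t→) = inf (_ , →f⇒→i t→ (InnermostNF⇒proper-subterms-NF t inf))
    InnermostNF⇒proper-subterms-NF (fun f ts) inf v (sub j v⊴tⱼ) =
      NF-⊴ v⊴tⱼ (InnermostNF⇒arguments-NF ts (λ j (_ , tⱼ→) → inf (_ , cong j tⱼ→)) j)
    InnermostNF⇒arguments-NF (t ∷ ts) inf zero    = InnermostNF⇒NF t (inf zero)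
    InnermostNF⇒arguments-NF (t ∷ ts) inf (suc j) = InnermostNF⇒arguments-NF ts (inf ∘ suc) j

    DerivationLengths : (Term → Term → Set) → ℕ → ℕω → Set
    DerivationLengths _⇒_ n y = ∃[ m ] y ≡ fin m × ∃[ t ] size t ≤ n × HasDerivation _⇒_ m t

    UpperBound-transfer : ∀ {_⇒_ _⇛_ n u} → (∀ {m t} → HasDerivation _⇒_ m t → ¬ ¬ HasDerivation _⇛_ m t) →
                          UpperBound (DerivationLengths _⇛_ n) u → UpperBound (DerivationLengths _⇒_ n) u
    UpperBound-transfer ⇒⇛ upper _ (m , refl , t , size≤n , d) =
      decidable-stable (fin m ≤ω? _) (¬¬-map (λ d′ → upper _ (m , refl , t , size≤n , d′)) (⇒⇛ d))

    IsDC-cong : ∀ {_⇒_ _⇛_ n x} →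
                (∀ {m t} → HasDerivation _⇒_ m t → ¬ ¬ HasDerivation _⇛_ m t) →
                (∀ {m t} → HasDerivation _⇛_ m t → ¬ ¬ HasDerivation _⇒_ m t) →
                IsDC _⇒_ n x → IsDC _⇛_ n x
    IsDC-cong ⇒⇛ ⇛⇒ = IsSup-cong (UpperBound-transfer ⇒⇛) (UpperBound-transfer ⇛⇒)

  module _ {I : Set} {ℛ : I → Rule} (trs : IsTRS I ℛ) (nonOverlapping : NonOverlapping ℛ)
           (leftLinear : LeftLinear ℛ) (rightLinear : RightLinear ℛ) where
    open Rewriting ℛ
    open IsTRS trs

    -- NonOverlapping permits a rule to overlap itself at the root, so root-diagram must decide
    -- whether two root redexes use the same rule.
    _≟ᴵ_ : DecidableEquality I
    _≟ᴵ_ = countable⇒decidableEquality countable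

    rhs-determined-by-lhs : ∀ i {σ σ′} → lhs ℛ i · σ ≡ lhs ℛ i · σ′ → rhs ℛ i · σ ≡ rhs ℛ i · σ′
    rhs-determined-by-lhs i eq = ·-cong (rhs ℛ i) λ x∈ → ·≡·⇒agree eq (vars-⊆ i _ x∈)

    lhs-properlyOverlapFree : ∀ i → ProperlyOverlapFree ℛ (lhs ℛ i)
    lhs-properlyOverlapFree i at π≢[] nonvar (i′ , unifiable) =
      nonOverlapping i i′ _ _ at nonvar (λ _ → π≢[]) unifiable

    data Joinable (s₁ u : Term) : Set where
      same   : u ≡ s₁ → Joinable s₁ u
      joined : ∀ {v} → s₁ →f v → ReflClosure _→i_ u v → Joinable s₁ u

    Joinable-[]≔ : ∀ {f} {ts : Vec Term (arity f)} j {s₁ u} → Joinable s₁ u →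
                   Joinable (fun f (ts [ j ]≔ s₁)) (fun f (ts [ j ]≔ u))
    Joinable-[]≔ {f} {ts} j (same eq) = same (≡.cong (λ t → fun f (ts [ j ]≔ t)) eq)
    Joinable-[]≔ {f} {ts} j (joined s₁→ u→) =
      joined (⇒-[]≔ _→f_ cong j s₁→) (ReflClosure.map (⇒-[]≔ _→i_ cong j) u→)

    local-diagram : ∀ {s s₁ u} → s →i s₁ → s →f u → Joinable s₁ u
    root-diagram : ∀ i {σ s u} → (∀ v → v ◁ (lhs ℛ i · σ) → NF v) → s ≡ lhs ℛ i · σ → s →f u →
                   Joinable (rhs ℛ i · σ) u
    argument-diagram : ∀ {f} {ts : Vec Term (arity f)} j {a s u} → lookup ts j →i a →
                       s ≡ fun f ts → s →f u → Joinable (fun f (ts [ j ]≔ a)) u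

    local-diagram (root i σ subterms-NF) s→u = root-diagram i subterms-NF refl s→u
    local-diagram (cong j tⱼ→a)          s→u = argument-diagram j tⱼ→a refl s→u

    root-diagram i {σ} _ eq (root i′ σ′) with i′ ≟ᴵ i
    ... | yes refl = same (rhs-determined-by-lhs i eq)
    ... | no  i′≢i = ⊥-elim (nonOverlapping i′ i [] _ root (lhs-nonvar i′) (λ i′≡i → contradiction i′≡i i′≢i)
                                            (σ′ , σ , eq))
    root-diagram i subterms-NF eq (cong j tⱼ→) =
      contradiction (_ , tⱼ→) (subterms-NF _ (subst (_ ◁_) eq (sub j refl⊴)))

    argument-diagram j tⱼ→a eq (root i σ)
      with →i-argument-step-in-lhs ℛ (lhs ℛ i) (lhs-nonvar i) (leftLinear i) (lhs-properlyOverlapFree i)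
                                    eq tⱼ→a
    ... | x , b , σx→b , eq′ =
      joined (subst (_→f (rhs ℛ i · σ [ x ↦ b ])) (sym eq′) (root i (σ [ x ↦ b ])))
             (·-[↦]-step⁼ _→i_ cong (rhs ℛ i) (rightLinear i x) σx→b)
    argument-diagram {f} {ts} j {a} tⱼ→a refl (cong {t' = t′} j′ tⱼ′→) with j ≟ᶠ j′
    ... | yes refl = Joinable-[]≔ j (local-diagram tⱼ→a tⱼ′→)
    ... | no  j≢j′ =
      joined (⇒-[]≔-other _→f_ cong (j≢j′ ∘ sym) tⱼ′→)
             [ subst (λ us → fun f (ts [ j′ ]≔ t′) →i fun f us) ([]≔-commutes ts j′ j (j≢j′ ∘ sym))
                     (⇒-[]≔-other _→i_ cong j≢j′ tⱼ→a) ]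

    →i-decreases-dh-by-at-most-one : ∀ k {s s₁} → s →i s₁ → HasDerivation ℛ _→f_ (suc k) s →
                                     HasDerivation ℛ _→f_ k s₁
    →i-decreases-dh-by-at-most-one k s→s₁ (_ , step s→u rest) with local-diagram s→s₁ s→u
    ... | same refl        = _ , rest
    ... | joined s₁→v refl = HasDerivation-pred ℛ (_ , step s₁→v rest)
    →i-decreases-dh-by-at-most-one zero    _ _                  | joined _ [ _ ] = _ , done
    →i-decreases-dh-by-at-most-one (suc k) _ (_ , step _ rest) | joined s₁→v [ u→v ] =
      map₂ (step s₁→v) (→i-decreases-dh-by-at-most-one k u→v (_ , rest))

    →f-derivation⇒¬¬→i-derivation : ∀ m {t} → HasDerivation ℛ _→f_ m t → ¬ ¬ HasDerivation ℛ _→i_ m t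
    →f-derivation⇒¬¬→i-derivation zero    _                      no-→i = no-→i (_ , done)
    →f-derivation⇒¬¬→i-derivation (suc m) {t} d@(_ , step t→ _) no-→i =
      InnermostNF⇒NF ℛ t (λ (t₁ , t→t₁) →
        →f-derivation⇒¬¬→i-derivation m (→i-decreases-dh-by-at-most-one m t→t₁ d)
          λ (t′ , d′) → no-→i (t′ , step t→t₁ d′))
        (_ , t→)

corollary4p8 : (F : Set) (arity : F → ℕ) (I : Set) (ℛ : I → TRS.Rule F arity) →
    TRS.IsTRS F arity I ℛ → TRS.Orthogonal F arity ℛ → TRS.RightLinear F arity ℛ →
    ∀ (n : ℕ) (x : ℕω) →
      (TRS.Rewriting.IsDC F arity ℛ (TRS.Rewriting._→f_ F arity ℛ) n x →
        TRS.Rewriting.IsDC F arity ℛ (TRS.Rewriting._→i_ F arity ℛ) n x)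
      × (TRS.Rewriting.IsDC F arity ℛ (TRS.Rewriting._→i_ F arity ℛ) n x →
        TRS.Rewriting.IsDC F arity ℛ (TRS.Rewriting._→f_ F arity ℛ) n x)
corollary4p8 F arity I ℛ trs (nonOverlapping , leftLinear) rightLinear n x =
  IsDC-cong F arity ℛ full⇒innermost innermost⇒full , IsDC-cong F arity ℛ innermost⇒full full⇒innermost
  where
  open TRS.Rewriting F arity ℛ using (_→f_; _→i_)

  full⇒innermost : ∀ {m t} → HasDerivation F arity ℛ _→f_ m t → ¬ ¬ HasDerivation F arity ℛ _→i_ m t
  full⇒innermost = →f-derivation⇒¬¬→i-derivation F arity trs nonOverlapping leftLinear rightLinear _

  innermost⇒full : ∀ {m t} → HasDerivation F arity ℛ _→i_ m t → ¬ ¬ HasDerivation F arity ℛ _→f_ m t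
  innermost⇒full d = contradiction (→i-derivation⇒→f-derivation F arity ℛ d)
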